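{- Let $G$ be a $2$-connected outerplanar graph on at least six vertices, and let $v,w_1,w_2$ be distinct vertices of $G$. Then $v$ has degree two with neighbours exactly $w_1$ and $w_2$ if and only if every connected triple of $G$ containing $v$ also contains $w_1$ or $w_2$, and there is no vertex $v'\notin\{v,w_1,w_2\}$ such that every connected triple of $G$ containing $v'$ also contains $w_1$ or $w_2$.
   Context: A connected triple of $G$ is a $3$-element subset $\{a,b,c\}\subseteq V(G)$ such that $G[\{a,b,c\}]$ is connected. A graph is $2$-connected if it has more than $2$ vertices and cannot be disconnected by removing fewer than $2$ vertices. -}

module Defs where

open import Data.Nat using (ℕ; _<_)
open import Data.Fin using (Fin; toℕ)
open import Data.Bool using (Bool; true)
open import Data.Product using (_×_; Σ; ∃)
open import Data.Sum using (_⊎_)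
open import Data.Unit using (⊤)
open import Data.Empty using (⊥)
open import Relation.Nullary using (¬_)
open import Relation.Binary.PropositionalEquality using (_≡_)
open import Function.Definitions using (Injective)

record Graph (n : ℕ) : Set where
  field
    adj     : Fin n → Fin n → Bool
    adj-sym : ∀ x y → adj x y ≡ adj y x
    irrefl  : ∀ x → ¬ (adj x x ≡ true)
open Graph public

Adj : ∀ {n} → Graph n → Fin n → Fin n → Set
Adj G x y = adj G x y ≡ true

data Reach {n : ℕ} (G : Graph n) (S : Fin n → Set) (x : Fin n) : Fin n → Set where
  here : S x → Reach G S x x
  step : ∀ {y z} → Reach G S x y → Adj G y z → S z → Reach G S x z

ConnectedOn : ∀ {n} → Graph n → (Fin n → Set) → Set
ConnectedOn {n} G S = (∃ λ x → S x) × (∀ x y → S x → S y → Reach G S x y)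

-- 2-connected: more than 2 vertices, and removing fewer than 2 vertices
-- (i.e. none or one) leaves a connected graph.
TwoConnected : ∀ {n} → Graph n → Set
TwoConnected {n} G =
  (2 < n) × ConnectedOn G (λ _ → ⊤) × (∀ u → ConnectedOn G (λ x → ¬ (x ≡ u)))

-- Outerplanar (combinatorial form): the vertices can be placed in a cyclic
-- order (on a circle) so that no two edges cross, i.e. there are no edges
-- ab, cd with pos a < pos c < pos b < pos d.
Outerplanar : ∀ {n} → Graph n → Set
Outerplanar {n} G = Σ (Fin n → Fin n) λ pos → Injective _≡_ _≡_ pos ×
  (∀ a b c d → Adj G a b → Adj G c d →
     toℕ (pos a) < toℕ (pos c) → toℕ (pos c) < toℕ (pos b) →
     toℕ (pos b) < toℕ (pos d) → ⊥)

_∈₃_ : ∀ {n} → Fin n → (Fin n × Fin n × Fin n) → Set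
x ∈₃ (a Data.Product., b Data.Product., c) = x ≡ a ⊎ x ≡ b ⊎ x ≡ c

ConnectedTriple : ∀ {n} → Graph n → Fin n → Fin n → Fin n → Set
ConnectedTriple G a b c =
  ¬ (a ≡ b) × ¬ (a ≡ c) × ¬ (b ≡ c) ×
  ConnectedOn G (λ x → x ∈₃ (a Data.Product., b Data.Product., c))

Hits : ∀ {n} → Graph n → Fin n → Fin n → Fin n → Set
Hits G u w₁ w₂ = ∀ a b c → ConnectedTriple G a b c →
  u ∈₃ (a Data.Product., b Data.Product., c) →
  w₁ ∈₃ (a Data.Product., b Data.Product., c) ⊎ w₂ ∈₃ (a Data.Product., b Data.Product., c)

-- v has degree two with neighbours exactly w₁ and w₂ (given w₁ ≠ w₂)
NbrsExactly : ∀ {n} → Graph n → Fin n → Fin n → Fin n → Set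
NbrsExactly G v w₁ w₂ = ∀ x → (Adj G v x → x ≡ w₁ ⊎ x ≡ w₂) × (x ≡ w₁ ⊎ x ≡ w₂ → Adj G v x)

{-# OPTIONS --safe #-}
module Submission where

-- If N(v) = {w₁, w₂}, every connected triple through v contains a neighbour of v, hence
-- w₁ or w₂. Conversely, a neighbour x ∉ {w₁, w₂} of v would inherit this hitting property,
-- so N(v) ⊆ {w₁, w₂}; as G − w is connected for every w, v is adjacent to both.
--
-- A second hitting vertex v′ has a component of at most two vertices in G − {w₁, w₂}. As
-- n ≥ 6, some y lies outside {v, w₁, w₂} and the components of v and v′; by 2-connectivity
-- the components of v, v′ and y all contain neighbours of both w₁ and w₂, a K₂,₃ minor. On
-- the circle of an outerplanar embedding, take neighbours c, d of w₁ in two of these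
-- components lying on the same side of w₁w₂: none of the three ways to pair up w₁, w₂, c, d
-- is crossing, whereas exactly one of them must be.

open import Defs
open import Data.Bool using (Bool; true; false; not; _xor_)
open import Data.Bool.Properties using (T-≡; xor-comm; xor-same) renaming (_≟_ to _≟ᴮ_)
open import Data.Bool.Solver using (module xor-∧-Solver)
open import Data.Empty using (⊥; ⊥-elim)
open import Data.Fin using (Fin; toℕ; _≟_)
open import Data.Fin.Properties using (any?; all?; ¬∀⟶∃¬; <⇒notInjective; toℕ-injective)
open import Data.List using (List; []; _∷_; length; lookup)
open import Data.List.Membership.Propositional using (_∉_)
open import Data.List.Relation.Unary.Any using (here; there; index)
open import Data.List.Relation.Unary.Any.Properties using (lookup-index)
open import Data.Nat using (ℕ; _≤_; _<_; _<ᵇ_; <-cmp)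
open import Data.Nat.Properties
  using (<⇒<ᵇ; <ᵇ-reflects-<; <-trans; <-irrefl; ≮⇒≥; ≤-antisym; ≤∧≢⇒<)
open import Data.Product using (_×_; ∃; _,_; proj₁; proj₂; swap)
open import Data.Sum using (_⊎_; inj₁; inj₂; [_,_]) renaming (map to map⊎; swap to swap⊎)
open import Function using (_∘_)
open import Function.Bundles using (Equivalence)
open import Function.Definitions using (Injective)
open import Relation.Binary.Definitions using (tri<; tri≈; tri>)
open import Relation.Binary.PropositionalEquality
  using (_≡_; _≢_; refl; sym; trans; cong; cong₂; subst; module ≡-Reasoning)
open import Relation.Nullary using (¬_; yes; no; contradiction)
open import Relation.Nullary.Decidable using (¬?; _×-dec_; decidable-stable)
open import Relation.Nullary.Reflects using (ofʸ; ofⁿ)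
open import Relation.Unary using (_⊆_)

<⇒<ᵇ≡true : ∀ {m n} → m < n → (m <ᵇ n) ≡ true
<⇒<ᵇ≡true = Equivalence.to T-≡ ∘ <⇒<ᵇ

<ᵇ-flip : ∀ {m n} → m ≢ n → (n <ᵇ m) ≡ not (m <ᵇ n)
<ᵇ-flip {m} {n} m≢n with m <ᵇ n | <ᵇ-reflects-< m n | n <ᵇ m | <ᵇ-reflects-< n m
... | true  | ofʸ m<n | true  | ofʸ n<m = contradiction (<-trans m<n n<m) (<-irrefl refl)
... | true  | ofʸ _   | false | ofⁿ _   = refl
... | false | ofⁿ _   | true  | ofʸ _   = refl
... | false | ofⁿ m≮n | false | ofⁿ n≮m = contradiction (≤-antisym (≮⇒≥ n≮m) (≮⇒≥ m≮n)) m≢n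

xor≡false⇒≡ : ∀ {x y} → x xor y ≡ false → x ≡ y
xor≡false⇒≡ {false} {false} _ = refl
xor≡false⇒≡ {true}  {true}  _ = refl

≡⇒xor≡false : ∀ {x y} → x ≡ y → x xor y ≡ false
≡⇒xor≡false {x} refl = xor-same x

two-of-three-equal : ∀ (x y z : Bool) → x ≡ y ⊎ x ≡ z ⊎ y ≡ z
two-of-three-equal false false _     = inj₁ refl
two-of-three-equal true  true  _     = inj₁ refl
two-of-three-equal false true  false = inj₂ (inj₁ refl)
two-of-three-equal true  false true  = inj₂ (inj₁ refl)
two-of-three-equal false true  true  = inj₂ (inj₂ refl)
two-of-three-equal true  false false = inj₂ (inj₂ refl)

-- For z ∉ {a, b}, side a b z holds iff z lies strictly between a and b. As an xor of
-- comparisons, the facts about four points below become Boolean-ring identities.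
side : ℕ → ℕ → ℕ → Bool
side a b z = (a <ᵇ z) xor (b <ᵇ z)

separates : ℕ → ℕ → ℕ → ℕ → Bool
separates a b c d = side a b c xor side a b d

separates-swapˡ : ∀ a b c d → separates a b c d ≡ separates b a c d
separates-swapˡ a b c d = cong₂ _xor_ (xor-comm (a <ᵇ c) (b <ᵇ c)) (xor-comm (a <ᵇ d) (b <ᵇ d))

separates-swapʳ : ∀ a b c d → separates a b c d ≡ separates a b d c
separates-swapʳ a b c d = xor-comm (side a b c) (side a b d)

separates-sym : ∀ {a b c d} → a ≢ c → a ≢ d → b ≢ c → b ≢ d →
                separates a b c d ≡ separates c d a b
separates-sym {a} {b} {c} {d} a≢c a≢d b≢c b≢d
  rewrite <ᵇ-flip a≢c | <ᵇ-flip a≢d | <ᵇ-flip b≢c | <ᵇ-flip b≢d =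
  solve 4 (λ ac bc ad bd →
             (ac :+ bc) :+ (ad :+ bd)
          := ((con true :+ ac) :+ (con true :+ ad)) :+ ((con true :+ bc) :+ (con true :+ bd)))
        refl (a <ᵇ c) (b <ᵇ c) (a <ᵇ d) (b <ᵇ d)
  where open xor-∧-Solver

-- Of the three ways to pair up four points on a circle, an odd number (in fact one) cross.
separates-pairings : ∀ {a b c d} → b ≢ c → b ≢ d → c ≢ d →
                     separates a b c d xor (separates a c b d xor separates a d b c) ≡ true
separates-pairings {a} {b} {c} {d} b≢c b≢d c≢d
  rewrite <ᵇ-flip b≢c | <ᵇ-flip b≢d | <ᵇ-flip c≢d =
  solve 6 (λ ab ac ad bc bd cd →
             ((ac :+ bc) :+ (ad :+ bd))
               :+ (((ab :+ (con true :+ bc)) :+ (ad :+ cd))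
                 :+ ((ab :+ (con true :+ bd)) :+ (ac :+ (con true :+ cd))))
          := con true)
        refl (a <ᵇ b) (a <ᵇ c) (a <ᵇ d) (b <ᵇ c) (b <ᵇ d) (c <ᵇ d)
  where open xor-∧-Solver

separates⇒interleaved : ∀ {a b c d} → c < d → a < c → b ≢ c →
                        separates a b c d ≡ true → c < b × b < d
separates⇒interleaved {a} {b} {c} {d} c<d a<c b≢c sep
  rewrite <⇒<ᵇ≡true a<c | <⇒<ᵇ≡true (<-trans a<c c<d)
  with b <ᵇ c | <ᵇ-reflects-< b c | b <ᵇ d | <ᵇ-reflects-< b d
... | false | ofⁿ b≮c | true  | ofʸ b<d = ≤∧≢⇒< (≮⇒≥ b≮c) (b≢c ∘ sym) , b<d
... | true  | ofʸ b<c | false | ofⁿ b≮d = contradiction (<-trans b<c c<d) b≮d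
... | true  | _       | true  | _       = contradiction sep λ ()
... | false | _       | false | _       = contradiction sep λ ()

∈∉⇒≢ : ∀ {A : Set} {Q : A → Set} {x y} → Q x → ¬ Q y → x ≢ y
∈∉⇒≢ x∈Q y∉Q refl = y∉Q x∈Q

fresh : ∀ {n} (xs : List (Fin n)) → length xs < n → ∃ λ y → y ∉ xs
fresh xs len<n with any? (λ y → all? (λ i → ¬? (lookup xs i ≟ y)))
... | yes (y , missed) = y , λ y∈xs → missed (index y∈xs) (sym (lookup-index y∈xs))
... | no ¬missed = ⊥-elim (<⇒notInjective len<n preimage-injective)
  where
    preimage : ∀ y → ∃ λ i → lookup xs i ≡ y
    preimage y with ¬∀⟶∃¬ _ _ (λ i → ¬? (lookup xs i ≟ y)) (λ missed → ¬missed (y , missed))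
    ... | i , ¬¬hit = i , decidable-stable (lookup xs i ≟ y) ¬¬hit

    preimage-injective : Injective _≡_ _≡_ (proj₁ ∘ preimage)
    preimage-injective {y} {y′} same =
      trans (sym (proj₂ (preimage y))) (trans (cong (lookup xs) same) (proj₂ (preimage y′)))

Avoiding : ∀ {n} → Fin n → Fin n → Fin n → Set
Avoiding w₁ w₂ t = t ≢ w₁ × t ≢ w₂

∉₃ : ∀ {n} {w a b c : Fin n} → a ≢ w → b ≢ w → c ≢ w → ¬ (w ∈₃ (a , b , c))
∉₃ a≢w _   _   (inj₁ w≡a)        = a≢w (sym w≡a)
∉₃ _   b≢w _   (inj₂ (inj₁ w≡b)) = b≢w (sym w≡b)
∉₃ _   _   c≢w (inj₂ (inj₂ w≡c)) = c≢w (sym w≡c)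

∈₃-third : ∀ {n} {w a b c : Fin n} → w ≢ a → w ≢ b → w ∈₃ (a , b , c) → w ≡ c
∈₃-third w≢a _   (inj₁ w≡a)        = contradiction w≡a w≢a
∈₃-third _   w≢b (inj₂ (inj₁ w≡b)) = contradiction w≡b w≢b
∈₃-third _   _   (inj₂ (inj₂ w≡c)) = w≡c

module _ {n} (G : Graph n) where

  Adj-sym : ∀ {x y} → Adj G x y → Adj G y x
  Adj-sym {x} {y} xy = trans (adj-sym G y x) xy

  Adj⇒≢ : ∀ {x y} → Adj G x y → x ≢ y
  Adj⇒≢ {x} xy refl = irrefl G x xy

module _ {n} {G : Graph n} where

  Reach-end : ∀ {S x y} → Reach G S x y → S y
  Reach-end (here s)     = s
  Reach-end (step _ _ s) = s

  Reach-trans : ∀ {S x y z} → Reach G S x y → Reach G S y z → Reach G S x z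
  Reach-trans r (here _)       = r
  Reach-trans r (step r′ yz s) = step (Reach-trans r r′) yz s

  Reach-sym : ∀ {S x y} → Reach G S x y → Reach G S y x
  Reach-sym (here s)      = here s
  Reach-sym (step r yz s) = Reach-trans (step (here s) (Adj-sym G yz) (Reach-end r)) (Reach-sym r)

  Reach-mono : ∀ {S T : Fin n → Set} {x y} → S ⊆ T → Reach G S x y → Reach G T x y
  Reach-mono S⊆T (here s)      = here (S⊆T s)
  Reach-mono S⊆T (step r yz s) = step (Reach-mono S⊆T r) yz (S⊆T s)

  Reach-component : ∀ {S x y} → Reach G S x y → Reach G (Reach G S x) x y
  Reach-component (here s)      = here (here s)
  Reach-component (step r yz s) = step (Reach-component r) yz (step r yz s)

  isolated-component : ∀ {S u z} → (∀ {t} → Adj G u t → ¬ S t) → Reach G S u z → z ≡ u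
  isolated-component no-nbr (here _) = refl
  isolated-component no-nbr (step r yz s) with isolated-component no-nbr r
  ... | refl = contradiction s (no-nbr yz)

  first-step : ∀ {S x z} → Reach G S x z → x ≢ z → ∃ λ u → Adj G x u × S u
  first-step (here _) x≢x = contradiction refl x≢x
  first-step {x = x} (step {y} r yz s) _ with x ≟ y
  ... | yes refl = _ , yz , s
  ... | no x≢y   = first-step r x≢y

  first-entry : ∀ {Q u z} w → Reach G Q u z → u ≢ w →
    Reach G (λ t → Q t × t ≢ w) u z ⊎ ∃ λ c → Reach G (λ t → Q t × t ≢ w) u c × Adj G c w
  first-entry w (here q) u≢w = inj₁ (here (q , u≢w))
  first-entry w (step {z = z} r yz q) u≢w with first-entry w r u≢w
  ... | inj₂ entered = inj₂ entered
  ... | inj₁ r′ with z ≟ w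
  ...   | yes refl = inj₂ (_ , r′ , yz)
  ...   | no z≢w   = inj₁ (step r′ yz (q , z≢w))

  reaches-neighbour : ∀ {u w w′} → ConnectedOn G (_≢ w′) → u ≢ w → u ≢ w′ → w ≢ w′ →
                      ∃ λ c → Reach G (Avoiding w′ w) u c × Adj G c w
  reaches-neighbour {u} {w} connected u≢w u≢w′ w≢w′
    with first-entry w (proj₂ connected u w u≢w′ w≢w′) u≢w
  ... | inj₁ avoiding = contradiction refl (proj₂ (Reach-end avoiding))
  ... | inj₂ entered  = entered

  forced-neighbour : ∀ {v w w′} → ConnectedOn G (_≢ w′) → v ≢ w → v ≢ w′ → w ≢ w′ →
                     (∀ {u} → Adj G v u → u ≡ w ⊎ u ≡ w′) → Adj G v w
  forced-neighbour connected v≢w v≢w′ w≢w′ nbrs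
    with first-step (proj₂ connected _ _ v≢w′ w≢w′) v≢w
  ... | u , vu , u≢w′ with nbrs vu
  ...   | inj₁ refl = vu
  ...   | inj₂ u≡w′ = contradiction u≡w′ u≢w′

  path-triple : ∀ {a b c} → Adj G a b → Adj G b c → a ≢ c → ConnectedTriple G a b c
  path-triple {a} {b} {c} ab bc a≢c =
    Adj⇒≢ G ab , a≢c , Adj⇒≢ G bc , (a , inj₁ refl) ,
    λ _ _ x∈ y∈ → Reach-trans (Reach-sym (from-b x∈)) (from-b y∈)
    where
      from-b : ∀ {x} → x ∈₃ (a , b , c) → Reach G (_∈₃ (a , b , c)) b x
      from-b (inj₁ refl)        = step (here (inj₂ (inj₁ refl))) (Adj-sym G ab) (inj₁ refl)
      from-b (inj₂ (inj₁ refl)) = here (inj₂ (inj₁ refl))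
      from-b (inj₂ (inj₂ refl)) = step (here (inj₂ (inj₁ refl))) bc (inj₂ (inj₂ refl))

  triple-neighbour : ∀ {a b c x} → ConnectedTriple G a b c → x ∈₃ (a , b , c) →
                     ∃ λ u → Adj G x u × u ∈₃ (a , b , c)
  triple-neighbour (a≢b , _ , _ , _ , reach) (inj₁ refl) =
    first-step (reach _ _ (inj₁ refl) (inj₂ (inj₁ refl))) a≢b
  triple-neighbour (a≢b , _ , _ , _ , reach) (inj₂ (inj₁ refl)) =
    first-step (reach _ _ (inj₂ (inj₁ refl)) (inj₁ refl)) (a≢b ∘ sym)
  triple-neighbour (_ , a≢c , _ , _ , reach) (inj₂ (inj₂ refl)) =
    first-step (reach _ _ (inj₂ (inj₂ refl)) (inj₁ refl)) (a≢c ∘ sym)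

  Hits⇒¬avoiding-triple : ∀ {u w₁ w₂ a b c} → Hits G u w₁ w₂ → ConnectedTriple G a b c →
    u ∈₃ (a , b , c) → Avoiding w₁ w₂ a → Avoiding w₁ w₂ b → Avoiding w₁ w₂ c → ⊥
  Hits⇒¬avoiding-triple hits triple u∈ (a≢w₁ , a≢w₂) (b≢w₁ , b≢w₂) (c≢w₁ , c≢w₂) =
    [ ∉₃ a≢w₁ b≢w₁ c≢w₁ , ∉₃ a≢w₂ b≢w₂ c≢w₂ ] (hits _ _ _ triple u∈)

  neighbours⇒hits : ∀ {v w₁ w₂} → NbrsExactly G v w₁ w₂ → Hits G v w₁ w₂
  neighbours⇒hits nbrs _ _ _ triple v∈ with triple-neighbour triple v∈
  ... | u , vu , u∈ with proj₁ (nbrs u) vu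
  ...   | inj₁ refl = inj₁ u∈
  ...   | inj₂ refl = inj₂ u∈

  Hits-neighbour : ∀ {v x w₁ w₂} → v ≢ w₁ → v ≢ w₂ → Hits G v w₁ w₂ →
                   Adj G v x → x ≢ w₁ → x ≢ w₂ → Hits G x w₁ w₂
  Hits-neighbour {v} {x} v≢w₁ v≢w₂ hits vx x≢w₁ x≢w₂ a b c triple x∈
    with triple-neighbour triple x∈
  ... | q , xq , q∈ with q ≟ v
  ...   | yes refl = hits a b c triple q∈
  ...   | no q≢v   =
    map⊎ (moved (v≢w₁ ∘ sym) (x≢w₁ ∘ sym)) (moved (v≢w₂ ∘ sym) (x≢w₂ ∘ sym))
      (hits v x q (path-triple vx xq (q≢v ∘ sym)) (inj₁ refl))
    where
      moved : ∀ {w} → w ≢ v → w ≢ x → w ∈₃ (v , x , q) → w ∈₃ (a , b , c)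
      moved w≢v w≢x w∈ rewrite ∈₃-third w≢v w≢x w∈ = q∈

  small-component : ∀ {u w₁ w₂} → Avoiding w₁ w₂ u → Hits G u w₁ w₂ →
                    ∃ λ x → ∀ {z} → Reach G (Avoiding w₁ w₂) u z → z ≡ u ⊎ z ≡ x
  small-component {u} {w₁} {w₂} u∈ hits
    with any? (λ t → (adj G u t ≟ᴮ true) ×-dec (¬? (t ≟ w₁) ×-dec ¬? (t ≟ w₂)))
  ... | no no-nbr = u , λ r → inj₁ (isolated-component (λ ut t∈ → no-nbr (_ , ut , t∈)) r)
  ... | yes (x , ux , x∈) = x , closed
    where
      nbr-of-u : ∀ {z} → Adj G u z → Avoiding w₁ w₂ z → z ≡ x
      nbr-of-u {z} uz z∈ with z ≟ x
      ... | yes z≡x = z≡x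
      ... | no z≢x  = ⊥-elim (Hits⇒¬avoiding-triple hits
                        (path-triple (Adj-sym G ux) uz (z≢x ∘ sym)) (inj₂ (inj₁ refl)) x∈ u∈ z∈)

      nbr-of-x : ∀ {z} → Adj G x z → Avoiding w₁ w₂ z → z ≡ u
      nbr-of-x {z} xz z∈ with z ≟ u
      ... | yes z≡u = z≡u
      ... | no z≢u  = ⊥-elim (Hits⇒¬avoiding-triple hits
                        (path-triple ux xz (z≢u ∘ sym)) (inj₁ refl) u∈ x∈ z∈)

      closed : ∀ {z} → Reach G (Avoiding w₁ w₂) u z → z ≡ u ⊎ z ≡ x
      closed (here _) = inj₁ refl
      closed (step r yz z∈) with closed r
      ... | inj₁ refl = inj₂ (nbr-of-u yz z∈)
      ... | inj₂ refl = inj₁ (nbr-of-x yz z∈)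

record Attachment {n} (G : Graph n) (w₁ w₂ r : Fin n) : Set where
  field
    foot₁       : Fin n
    foot₁-reach : Reach G (Avoiding w₁ w₂) r foot₁
    foot₁-adj   : Adj G foot₁ w₁
    foot₂       : Fin n
    foot₂-reach : Reach G (Avoiding w₁ w₂) r foot₂
    foot₂-adj   : Adj G foot₂ w₂
open Attachment

attachment : ∀ {n} {G : Graph n} {w₁ w₂ r} → TwoConnected G → w₁ ≢ w₂ →
             Avoiding w₁ w₂ r → Attachment G w₁ w₂ r
attachment (_ , _ , connected-without) w₁≢w₂ (r≢w₁ , r≢w₂)
  with c₁ , reach₁ , c₁w₁ ← reaches-neighbour (connected-without _) r≢w₁ r≢w₂ w₁≢w₂
  with c₂ , reach₂ , c₂w₂ ← reaches-neighbour (connected-without _) r≢w₂ r≢w₁ (w₁≢w₂ ∘ sym)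
  = record { foot₁ = c₁ ; foot₁-reach = Reach-mono swap reach₁ ; foot₁-adj = c₁w₁
           ; foot₂ = c₂ ; foot₂-reach = reach₂ ; foot₂-adj = c₂w₂ }

module Chords {n} {G : Graph n} (outerplanar : Outerplanar G) where

  p : Fin n → ℕ
  p = toℕ ∘ proj₁ outerplanar

  p-injective : ∀ {a b} → a ≢ b → p a ≢ p b
  p-injective a≢b pa≡pb = a≢b (proj₁ (proj₂ outerplanar) (toℕ-injective pa≡pb))

  chords-do-not-separate-from-left : ∀ {a b c d} → Adj G a b → Adj G c d →
    p c < p d → p a < p c → b ≢ c → separates (p a) (p b) (p c) (p d) ≡ false
  chords-do-not-separate-from-left {a} {b} {c} {d} ab cd c<d a<c b≢c
    with separates (p a) (p b) (p c) (p d) in sep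
  ... | false = refl
  ... | true with c<b , b<d ← separates⇒interleaved c<d a<c (p-injective b≢c) sep =
    ⊥-elim (proj₂ (proj₂ outerplanar) a b c d ab cd a<c c<b b<d)

  oriented-chords-do-not-separate : ∀ {a b c d} → Adj G a b → Adj G c d → p a < p b → p c < p d →
    c ≢ a → c ≢ b → d ≢ a → d ≢ b → separates (p a) (p b) (p c) (p d) ≡ false
  oriented-chords-do-not-separate {a} {c = c} ab cd a<b c<d c≢a c≢b d≢a d≢b
    with <-cmp (p a) (p c)
  ... | tri< a<c _ _ = chords-do-not-separate-from-left ab cd c<d a<c (c≢b ∘ sym)
  ... | tri≈ _ pa≡pc _ = contradiction (sym pa≡pc) (p-injective c≢a)
  ... | tri> _ _ c<a = trans
    (separates-sym (p-injective (c≢a ∘ sym)) (p-injective (d≢a ∘ sym))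
                   (p-injective (c≢b ∘ sym)) (p-injective (d≢b ∘ sym)))
    (chords-do-not-separate-from-left cd ab a<b c<a d≢a)

  chords-do-not-separate : ∀ {a b c d} → Adj G a b → Adj G c d →
    c ≢ a → c ≢ b → d ≢ a → d ≢ b → separates (p a) (p b) (p c) (p d) ≡ false
  chords-do-not-separate {a} {b} {c} {d} ab cd c≢a c≢b d≢a d≢b
    with <-cmp (p a) (p b) | <-cmp (p c) (p d)
  ... | tri≈ _ pa≡pb _ | _ = contradiction pa≡pb (p-injective (Adj⇒≢ G ab))
  ... | _ | tri≈ _ pc≡pd _ = contradiction pc≡pd (p-injective (Adj⇒≢ G cd))
  ... | tri< a<b _ _ | tri< c<d _ _ =
    oriented-chords-do-not-separate ab cd a<b c<d c≢a c≢b d≢a d≢b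
  ... | tri< a<b _ _ | tri> _ _ d<c = trans (separates-swapʳ (p a) (p b) (p c) (p d))
    (oriented-chords-do-not-separate ab (Adj-sym G cd) a<b d<c d≢a d≢b c≢a c≢b)
  ... | tri> _ _ b<a | tri< c<d _ _ = trans (separates-swapˡ (p a) (p b) (p c) (p d))
    (oriented-chords-do-not-separate (Adj-sym G ab) cd b<a c<d c≢b c≢a d≢b d≢a)
  ... | tri> _ _ b<a | tri> _ _ d<c = trans (separates-swapˡ (p a) (p b) (p c) (p d))
    (trans (separates-swapʳ (p b) (p a) (p c) (p d))
      (oriented-chords-do-not-separate (Adj-sym G ab) (Adj-sym G cd) b<a d<c d≢b d≢a c≢b c≢a))

  chord-side : ∀ {a b c d} → Adj G a b → Adj G c d → c ≢ a → c ≢ b → d ≢ a → d ≢ b →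
               side (p a) (p b) (p c) ≡ side (p a) (p b) (p d)
  chord-side ab cd c≢a c≢b d≢a d≢b = xor≡false⇒≡ (chords-do-not-separate ab cd c≢a c≢b d≢a d≢b)

  side-invariant : ∀ {Q a b u z} → Adj G a b → ¬ Q a → ¬ Q b → Reach G Q u z →
                   side (p a) (p b) (p u) ≡ side (p a) (p b) (p z)
  side-invariant ab a∉Q b∉Q (here _) = refl
  side-invariant ab a∉Q b∉Q (step r yz z∈Q) = trans (side-invariant ab a∉Q b∉Q r)
    (chord-side ab yz (∈∉⇒≢ y∈Q a∉Q) (∈∉⇒≢ y∈Q b∉Q) (∈∉⇒≢ z∈Q a∉Q) (∈∉⇒≢ z∈Q b∉Q))
    where y∈Q = Reach-end r

  module _ {w₁ w₂ : Fin n} (w₁≢w₂ : w₁ ≢ w₂) where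
    open ≡-Reasoning

    foot₁-chord-does-not-separate : ∀ {r s} → ¬ Reach G (Avoiding w₁ w₂) s r →
      (A : Attachment G w₁ w₂ r) (B : Attachment G w₁ w₂ s) →
      side (p w₁) (p (foot₁ A)) (p (foot₁ B)) ≡ side (p w₁) (p (foot₁ A)) (p w₂)
    foot₁-chord-does-not-separate {s = s} s↛r A B = begin
      side (p w₁) (p c) (p (foot₁ B))
        ≡⟨ side-invariant w₁c w₁∉ c∉ (Reach-sym (Reach-component (foot₁-reach B))) ⟩
      side (p w₁) (p c) (p s)
        ≡⟨ side-invariant w₁c w₁∉ c∉ (Reach-component (foot₂-reach B)) ⟩
      side (p w₁) (p c) (p (foot₂ B))
        ≡⟨ chord-side w₁c (foot₂-adj B) (∈∉⇒≢ (foot₂-reach B) w₁∉) (∈∉⇒≢ (foot₂-reach B) c∉)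
                      (w₁≢w₂ ∘ sym) w₂≢c ⟩
      side (p w₁) (p c) (p w₂) ∎
      where
        c = foot₁ A

        component : Fin n → Set
        component = Reach G (Avoiding w₁ w₂) s

        w₁c : Adj G w₁ c
        w₁c = Adj-sym G (foot₁-adj A)

        w₁∉ : ¬ component w₁
        w₁∉ walk = proj₁ (Reach-end walk) refl

        c∉ : ¬ component c
        c∉ walk = s↛r (Reach-trans walk (Reach-sym (foot₁-reach A)))

        w₂≢c : w₂ ≢ c
        w₂≢c = proj₂ (Reach-end (foot₁-reach A)) ∘ sym

    foot₁-side : ∀ {r} → Attachment G w₁ w₂ r → Bool
    foot₁-side A = side (p w₁) (p w₂) (p (foot₁ A))

    feet-on-different-sides : ∀ {r s} → ¬ Reach G (Avoiding w₁ w₂) r s →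
      (A : Attachment G w₁ w₂ r) (B : Attachment G w₁ w₂ s) → foot₁-side A ≢ foot₁-side B
    feet-on-different-sides r↛s A B same = contradiction (begin
      false
        ≡⟨ sym none-separates ⟩
      separates a b c d xor (separates a c b d xor separates a d b c)
        ≡⟨ separates-pairings b≢c b≢d c≢d ⟩
      true ∎) λ ()
      where
        a = p w₁
        b = p w₂
        c = p (foot₁ A)
        d = p (foot₁ B)

        none-separates : separates a b c d xor (separates a c b d xor separates a d b c) ≡ false
        none-separates = cong₂ _xor_ (≡⇒xor≡false same) (cong₂ _xor_
          (≡⇒xor≡false (sym (foot₁-chord-does-not-separate (r↛s ∘ Reach-sym) A B)))
          (≡⇒xor≡false (sym (foot₁-chord-does-not-separate r↛s B A))))

        b≢c : b ≢ c
        b≢c = p-injective (proj₂ (Reach-end (foot₁-reach A)) ∘ sym)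
        b≢d : b ≢ d
        b≢d = p-injective (proj₂ (Reach-end (foot₁-reach B)) ∘ sym)
        c≢d : c ≢ d
        c≢d = p-injective λ feet≡ → r↛s (Reach-trans (foot₁-reach A)
                (Reach-sym (subst (Reach G _ _) (sym feet≡) (foot₁-reach B))))

    no-K₂,₃ : ∀ {r₁ r₂ r₃} →
      ¬ Reach G (Avoiding w₁ w₂) r₁ r₂ → ¬ Reach G (Avoiding w₁ w₂) r₁ r₃ →
      ¬ Reach G (Avoiding w₁ w₂) r₂ r₃ → Attachment G w₁ w₂ r₁ → Attachment G w₁ w₂ r₂ →
      Attachment G w₁ w₂ r₃ → ⊥
    no-K₂,₃ r₁↛r₂ r₁↛r₃ r₂↛r₃ A₁ A₂ A₃
      with two-of-three-equal (foot₁-side A₁) (foot₁-side A₂) (foot₁-side A₃)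
    ... | inj₁ same        = feet-on-different-sides r₁↛r₂ A₁ A₂ same
    ... | inj₂ (inj₁ same) = feet-on-different-sides r₁↛r₃ A₁ A₃ same
    ... | inj₂ (inj₂ same) = feet-on-different-sides r₂↛r₃ A₂ A₃ same

module _ {n} {G : Graph n} {v w₁ w₂ : Fin n}
         (v≢w₁ : v ≢ w₁) (v≢w₂ : v ≢ w₂) (w₁≢w₂ : w₁ ≢ w₂) where

  OtherHitter : Set
  OtherHitter = ∃ λ v′ → v′ ≢ v × v′ ≢ w₁ × v′ ≢ w₂ × Hits G v′ w₁ w₂

  neighbours⇒no-other-hitter : 6 ≤ n → TwoConnected G → Outerplanar G →
                               NbrsExactly G v w₁ w₂ → ¬ OtherHitter
  neighbours⇒no-other-hitter 6≤n two-connected outerplanar nbrs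
                             (v′ , v′≢v , v′≢w₁ , v′≢w₂ , hits′)
    with x , component-v′ ← small-component (v′≢w₁ , v′≢w₂) hits′
    with y , y∉ ← fresh (v ∷ w₁ ∷ w₂ ∷ v′ ∷ x ∷ []) 6≤n
    = no-K₂,₃ w₁≢w₂ v↛v′ v↛y v′↛y
        (attached (v≢w₁ , v≢w₂)) (attached (v′≢w₁ , v′≢w₂)) (attached (y≢w₁ , y≢w₂))
    where
      open Chords outerplanar

      attached : ∀ {r} → Avoiding w₁ w₂ r → Attachment G w₁ w₂ r
      attached = attachment two-connected w₁≢w₂

      y≢v : y ≢ v
      y≢v = y∉ ∘ here
      y≢w₁ : y ≢ w₁
      y≢w₁ = y∉ ∘ there ∘ here
      y≢w₂ : y ≢ w₂
      y≢w₂ = y∉ ∘ there ∘ there ∘ here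
      y≢v′ : y ≢ v′
      y≢v′ = y∉ ∘ there ∘ there ∘ there ∘ here
      y≢x : y ≢ x
      y≢x = y∉ ∘ there ∘ there ∘ there ∘ there ∘ here

      component-v : ∀ {z} → Reach G (Avoiding w₁ w₂) v z → z ≡ v
      component-v = isolated-component λ vt (t≢w₁ , t≢w₂) → [ t≢w₁ , t≢w₂ ] (proj₁ (nbrs _) vt)

      v↛v′ : ¬ Reach G (Avoiding w₁ w₂) v v′
      v↛v′ = v′≢v ∘ component-v

      v↛y : ¬ Reach G (Avoiding w₁ w₂) v y
      v↛y = y≢v ∘ component-v

      v′↛y : ¬ Reach G (Avoiding w₁ w₂) v′ y
      v′↛y = [ y≢v′ , y≢x ] ∘ component-v′

  hits∧no-other-hitter⇒neighbours : TwoConnected G → Hits G v w₁ w₂ → ¬ OtherHitter →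
                                    NbrsExactly G v w₁ w₂
  hits∧no-other-hitter⇒neighbours (_ , _ , connected-without) hits no-other x = nbr⇒w , w⇒nbr
    where
      nbr⇒w : ∀ {u} → Adj G v u → u ≡ w₁ ⊎ u ≡ w₂
      nbr⇒w {u} vu with u ≟ w₁ | u ≟ w₂
      ... | yes u≡w₁ | _        = inj₁ u≡w₁
      ... | no _     | yes u≡w₂ = inj₂ u≡w₂
      ... | no u≢w₁  | no u≢w₂  = contradiction
        (u , Adj⇒≢ G vu ∘ sym , u≢w₁ , u≢w₂ , Hits-neighbour v≢w₁ v≢w₂ hits vu u≢w₁ u≢w₂) no-other

      w⇒nbr : x ≡ w₁ ⊎ x ≡ w₂ → Adj G v x
      w⇒nbr (inj₁ refl) = forced-neighbour (connected-without w₂) v≢w₁ v≢w₂ w₁≢w₂ nbr⇒w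
      w⇒nbr (inj₂ refl) =
        forced-neighbour (connected-without w₁) v≢w₂ v≢w₁ (w₁≢w₂ ∘ sym) (swap⊎ ∘ nbr⇒w)

lemma5 : (n : ℕ) (G : Graph n) → 6 ≤ n → TwoConnected G → Outerplanar G →
    (v w₁ w₂ : Fin n) → ¬ (v ≡ w₁) → ¬ (v ≡ w₂) → ¬ (w₁ ≡ w₂) →
    (NbrsExactly G v w₁ w₂ →
       Hits G v w₁ w₂ × ¬ (∃ λ v' → ¬ (v' ≡ v) × ¬ (v' ≡ w₁) × ¬ (v' ≡ w₂) × Hits G v' w₁ w₂))
    × (Hits G v w₁ w₂ × ¬ (∃ λ v' → ¬ (v' ≡ v) × ¬ (v' ≡ w₁) × ¬ (v' ≡ w₂) × Hits G v' w₁ w₂) →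
       NbrsExactly G v w₁ w₂)
lemma5 _ _ 6≤n two-connected outerplanar v w₁ w₂ v≢w₁ v≢w₂ w₁≢w₂ =
    (λ nbrs → neighbours⇒hits nbrs
            , neighbours⇒no-other-hitter v≢w₁ v≢w₂ w₁≢w₂ 6≤n two-connected outerplanar nbrs)
  , λ (hits , no-other) →
      hits∧no-other-hitter⇒neighbours v≢w₁ v≢w₂ w₁≢w₂ two-connected hits no-other
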